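{- For each $t \in \mathbb{N}$ there exists $L_t > 0$ such that $\min\{E_{n,t}, O_{n,t}\} \geq L_t\, n!$ for all $n \geq 2t+2$.
   Context: $E_{n,t}$ (resp. $O_{n,t}$) denotes the number of even (resp. odd) permutations in $S_n$ that have no cycle of length at most $t$. -}

module Defs where

open import Data.Nat using (ℕ; zero; suc; _+_; _*_; _%_; _≡ᵇ_; _<ᵇ_)
open import Data.Bool using (Bool; true; false; _∧_; _∨_; not)
open import Data.Fin using (Fin; toℕ)
open import Data.Fin.Properties using () renaming (_≟_ to _≟ᶠ_)
open import Data.Vec using (Vec; []; _∷_; lookup)
open import Data.List using (List; []; _∷_; [_]; map; concatMap; length; filterᵇ; allFin; upTo)
open import Data.Bool.ListAction using (all)
open import Relation.Nullary.Decidable using (⌊_⌋)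

-- A permutation of {0,…,n-1} in one-line notation: a vector v of length n
-- (v i = image of i) whose entries are pairwise distinct.

allVecs : (n m : ℕ) → List (Vec (Fin n) m)
allVecs n zero = [ [] ]
allVecs n (suc m) = concatMap (λ x → map (x ∷_) (allVecs n m)) (allFin n)

_==ᶠ_ : ∀ {n} → Fin n → Fin n → Bool
i ==ᶠ j = ⌊ i ≟ᶠ j ⌋

isPermᵇ : ∀ {n} → Vec (Fin n) n → Bool
isPermᵇ {n} v = all (λ i → all (λ j → (i ==ᶠ j) ∨ not (lookup v i ==ᶠ lookup v j)) (allFin n)) (allFin n)

inversions : ∀ {n} → Vec (Fin n) n → ℕ
inversions {n} v = length (filterᵇ (λ p → inv (Data.Vec.lookup p zeroF) (Data.Vec.lookup p oneF)) pairs)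
  where
  open import Data.Fin using () renaming (zero to zeroF; suc to sucF)
  oneF = sucF zeroF
  pairs : List (Vec (Fin n) 2)
  pairs = allVecs n 2
  inv : Fin n → Fin n → Bool
  inv i j = (toℕ i <ᵇ toℕ j) ∧ (toℕ (lookup v j) <ᵇ toℕ (lookup v i))

isEvenᵇ : ∀ {n} → Vec (Fin n) n → Bool
isEvenᵇ v = (inversions v % 2) ≡ᵇ 0

iter : ∀ {n} → Vec (Fin n) n → ℕ → Fin n → Fin n
iter v zero i = i
iter v (suc k) i = lookup v (iter v k i)

-- no cycle of length ≤ t: no point i and 1 ≤ k ≤ t with v^k(i) = i
-- (the cycle containing i has length = least k ≥ 1 with v^k(i) = i)
noShortCycleᵇ : ∀ {n} → ℕ → Vec (Fin n) n → Bool
noShortCycleᵇ {n} t v = all (λ i → all (λ k → not (iter v (suc k) i ==ᶠ i)) (upTo t)) (allFin n)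

E : ℕ → ℕ → ℕ
E n t = length (filterᵇ (λ v → isPermᵇ v ∧ isEvenᵇ v ∧ noShortCycleᵇ t v) (allVecs n n))

O : ℕ → ℕ → ℕ
O n t = length (filterᵇ (λ v → isPermᵇ v ∧ not (isEvenᵇ v) ∧ noShortCycleᵇ t v) (allVecs n n))

-- Classify the permutations of {0, …, N} by the length N - m + 1 of the cycle through 0. A permutation
-- σ of the remaining m points without short cycles, together with one of the N!/m! ways of placing the
-- points of that cycle, gives such a permutation, whose parity is that of σ shifted by N - m. So for
-- either parity the number a(N+1) of permutations without cycles of length ≤ t is at least
-- Σ_{m ≤ N-t} a'(m) N!/m!, where a' counts the appropriate parity. By induction c a(m) ≥ m! for
-- m ≥ 2t+2, where c = (3t+2)(t+1): each class with m ≥ 2t+2 has size at least N!/c, and of the classes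
-- m = 0 (a single (N+1)-cycle) and m = t+1 (completed by one of the t! cycles of length t+1) one has
-- the right parity and size at least N!/(t+1). Summing, c a(N+1) ≥ (N - 3t - 1 + 3t + 2) N! = (N+1)!, and L_t = 1/c.
module Submission where

open import Data.Bool using (Bool; true; false; not; _∧_; _∨_; _xor_; T; T?; if_then_else_)
open import Data.Bool.ListAction using (all)
open import Data.Bool.Properties
  using (T-∧; T-∨; ∧-zeroʳ; not-involutive; not-distribˡ-xor; xor-assoc; xor-comm; xor-same; xor-identityʳ)
open import Data.Empty using (⊥; ⊥-elim)
open import Data.Fin using (Fin; zero; suc; toℕ; fromℕ; inject₁; _↑ˡ_; _↑ʳ_; splitAt; punchOut)
open import Data.Fin.Permutation
  using (Permutation′; permutation; _⟨$⟩ʳ_; _⟨$⟩ˡ_; inverseˡ; inverseʳ; lift₀; transpose; _∘ₚ_)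
import Data.Fin.Permutation as Perm
open import Data.Fin.Properties
  using (toℕ-injective; toℕ-fromℕ; toℕ-inject₁; toℕ<n; toℕ-↑ˡ; toℕ-↑ʳ; fromℕ≢inject₁; inject₁-injective;
         splitAt-↑ˡ; splitAt-↑ʳ; splitAt⁻¹-↑ˡ; splitAt⁻¹-↑ʳ; ↑ˡ-injective; ↑ʳ-injective; suc-injective;
         punchOut-injective; any?; injective⇒≤)
  renaming (_≟_ to _≟ᶠ_)
open import Data.Integer using (+_; +≤+; +<+) renaming (_*_ to _*ℤ_; _≤_ to _≤ℤ_)
import Data.Integer.Properties as ℤ
open import Data.List
  using (List; []; _∷_; [_]; map; concatMap; length; filterᵇ; allFin; upTo; tabulate; _++_; cartesianProductWith)
open import Data.List.Membership.Propositional using (_∈_)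
open import Data.List.Membership.Propositional.Properties
  using (∈-allFin; ∈-filter⁺; ∈-filter⁻; ∈-++⁻; ∈-cartesianProductWith⁺; ∈-cartesianProductWith⁻; ∈-upTo⁺; ∈-upTo⁻)
open import Data.List.Properties using (length-++; length-map; length-removeAt′; length-tabulate; filter-++)
open import Data.List.Relation.Binary.Subset.Propositional using (_⊆_)
open import Data.List.Relation.Unary.All using (All; [])
import Data.List.Relation.Unary.All as All
open import Data.List.Relation.Unary.AllPairs using ([]; _∷_)
open import Data.List.Relation.Unary.Any using (here; there; index; _─_)
open import Data.List.Relation.Unary.Unique.Propositional using (Unique)
open import Data.List.Relation.Unary.Unique.Propositional.Properties
  using (cartesianProductWith⁺; allFin⁺; filter⁺; ++⁺)
open import Data.Nat
  using (ℕ; NonZero; zero; suc; pred; _+_; _*_; _∸_; _≤_; _<_; _⊓_; _!; _<ᵇ_; _≡ᵇ_; _%_; z≤n; s≤s; s≤s⁻¹; _≤?_)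
open import Data.Nat.Induction using (<-rec)
open import Data.Nat.Properties hiding (suc-injective)
open import Data.Nat.Tactic.RingSolver using (solve-∀)
open import Algebra.Properties.Semiring.Sum +-*-semiring
  using (sum; sum-syntax; sum-cong-≗; ∑-comm; ∑-distrib-+; sum-permute; sum-replicate-zero; *-distribˡ-sum)
open import Data.Product using (Σ; ∃; _×_; _,_; proj₁; proj₂)
open import Data.Rational using (ℚ; 0ℚ; _/_; toℚᵘ; fromℚᵘ) renaming (_<_ to _<ℚ_; _≤_ to _≤ℚ_; _*_ to _*ℚ_)
open import Data.Rational.Properties using (toℚᵘ-cancel-≤; toℚᵘ-cancel-<; toℚᵘ-homo-*; toℚᵘ-fromℚᵘ)
open import Data.Rational.Unnormalised using (mkℚᵘ; *≤*; *<*) renaming (_≤_ to _≤ᵘ_; _*_ to _*ᵘ_; _≃_ to _≃ᵘ_)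
open import Data.Rational.Unnormalised.Properties using (≤-respˡ-≃; ≤-respʳ-≃; <-respʳ-≃; *-cong; ≃-sym; ≃-trans)
open import Data.Sum using (inj₁; inj₂; [_,_]′)
open import Data.Unit using (⊤; tt)
open import Data.Vec using (Vec; []; _∷_; lookup)
import Data.Vec as Vec
open import Data.Vec.Properties using (∷-injective; lookup∘tabulate; tabulate∘lookup; tabulate-cong)
open import Function using (_∘_; id; Equivalence)
open import Function.Definitions using (Injective)
open import Relation.Binary using (tri<; tri≈; tri>)
open import Relation.Binary.PropositionalEquality hiding ([_])
open import Relation.Nullary using (¬_; yes; no)
open import Relation.Nullary.Decidable using (dec-true; dec-false; toWitness; toWitnessFalse; fromWitnessFalse)

open import Defs

private variable
  A B : Set
  k m n t : ℕ

all⁻ : (p : A → Bool) (xs : List A) → T (all p xs) → ∀ {x} → x ∈ xs → T (p x)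
all⁻ p (y ∷ ys) h (here refl) = proj₁ (Equivalence.to T-∧ h)
all⁻ p (y ∷ ys) h (there x∈) = all⁻ p ys (proj₂ (Equivalence.to T-∧ h)) x∈

all⁺ : (p : A → Bool) (xs : List A) → (∀ {x} → x ∈ xs → T (p x)) → T (all p xs)
all⁺ p [] h = tt
all⁺ p (y ∷ ys) h = Equivalence.from T-∧ (h (here refl) , all⁺ p ys (h ∘ there))

all-all⁻ : (p : A → B → Bool) (xs : List A) (ys : List B) → T (all (λ x → all (p x) ys) xs) →
           ∀ {x y} → x ∈ xs → y ∈ ys → T (p x y)
all-all⁻ p xs ys h x∈ = all⁻ (p _) ys (all⁻ (λ x → all (p x) ys) xs h x∈)

all-all⁺ : (p : A → B → Bool) (xs : List A) (ys : List B) → (∀ {x y} → x ∈ xs → y ∈ ys → T (p x y)) →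
           T (all (λ x → all (p x) ys) xs)
all-all⁺ p xs ys h = all⁺ (λ x → all (p x) ys) xs (λ x∈ → all⁺ (p _) ys (h x∈))

∈-─ : ∀ {x y : A} {ys} (p : x ∈ ys) → y ∈ ys → y ≢ x → y ∈ (ys ─ p)
∈-─ (here refl) (here refl) y≢x = ⊥-elim (y≢x refl)
∈-─ (here refl) (there q) _ = q
∈-─ (there p) (here refl) _ = here refl
∈-─ (there p) (there q) y≢x = there (∈-─ p q y≢x)

Unique⇒length≤ : ∀ {xs ys : List A} → Unique xs → xs ⊆ ys → length xs ≤ length ys
Unique⇒length≤ {xs = []} _ _ = z≤n
Unique⇒length≤ {xs = x ∷ xs} {ys} (x∉xs ∷ xs!) xs⊆ys = begin
  suc (length xs)        ≤⟨ s≤s (Unique⇒length≤ xs! xs⊆ys─x) ⟩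
  suc (length (ys ─ x∈)) ≡⟨ length-removeAt′ ys (index x∈) ⟨
  length ys              ∎
  where
  open ≤-Reasoning
  x∈ = xs⊆ys (here refl)
  xs⊆ys─x : xs ⊆ (ys ─ x∈)
  xs⊆ys─x y∈xs = ∈-─ x∈ (xs⊆ys (there y∈xs)) (λ y≡x → All.lookup x∉xs y∈xs (sym y≡x))

length-cartesianProductWith : ∀ {C : Set} (f : A → B → C) xs ys →
                              length (cartesianProductWith f xs ys) ≡ length xs * length ys
length-cartesianProductWith f [] ys = refl
length-cartesianProductWith f (x ∷ xs) ys =
  trans (length-++ (map (f x) ys)) (cong₂ _+_ (length-map (f x) ys) (length-cartesianProductWith f xs ys))

allVecs-suc : ∀ n m → allVecs n (suc m) ≡ cartesianProductWith _∷_ (allFin n) (allVecs n m)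
allVecs-suc n m = go (allFin n)
  where
  go : (xs : List (Fin n)) → concatMap (λ x → map (x ∷_) (allVecs n m)) xs ≡ cartesianProductWith _∷_ xs (allVecs n m)
  go [] = refl
  go (x ∷ xs) = cong (map (x ∷_) (allVecs n m) ++_) (go xs)

allVecs-unique : ∀ n m → Unique (allVecs n m)
allVecs-unique n zero = [] ∷ []
allVecs-unique n (suc m) rewrite allVecs-suc n m =
  cartesianProductWith⁺ _∷_ ∷-injective (allFin⁺ n) (allVecs-unique n m)

∈-allVecs : ∀ n m (v : Vec (Fin n) m) → v ∈ allVecs n m
∈-allVecs n zero [] = here refl
∈-allVecs n (suc m) (x ∷ v) rewrite allVecs-suc n m =
  ∈-cartesianProductWith⁺ _∷_ (∈-allFin x) (∈-allVecs n m v)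

countVecs : ∀ n → (Vec (Fin n) n → Bool) → ℕ
countVecs n Q = length (filterᵇ Q (allVecs n n))

Unique⇒length≤countVecs : ∀ n (Q : Vec (Fin n) n → Bool) {vs} →
                          Unique vs → All (T ∘ Q) vs → length vs ≤ countVecs n Q
Unique⇒length≤countVecs n Q vs! Qvs =
  Unique⇒length≤ vs! (λ v∈ → ∈-filter⁺ (T? ∘ Q) (∈-allVecs n n _) (All.lookup Qvs v∈))

𝟙 : Bool → ℕ
𝟙 b = if b then 1 else 0

_<ᶠ_ : Fin n → Fin n → Bool
i <ᶠ j = toℕ i <ᵇ toℕ j

<ᶠ-true : ∀ {i j : Fin n} → toℕ i < toℕ j → (i <ᶠ j) ≡ true
<ᶠ-true {i = i} {j} = dec-true (toℕ i <? toℕ j)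

<ᶠ-false : ∀ {i j : Fin n} → ¬ toℕ i < toℕ j → (i <ᶠ j) ≡ false
<ᶠ-false {i = i} {j} = dec-false (toℕ i <? toℕ j)

<ᶠ-irrefl : (i : Fin n) → (i <ᶠ i) ≡ false
<ᶠ-irrefl i = <ᶠ-false {i = i} {i} (<-irrefl refl)

<ᶠ-asym : ∀ {i j : Fin n} → (i <ᶠ j) ≡ true → (j <ᶠ i) ≡ false
<ᶠ-asym {i = i} {j} i<j = <ᶠ-false (<-asym (<ᵇ⇒< (toℕ i) (toℕ j) (subst T (sym i<j) tt)))

<ᶠ-flip : ∀ {i j : Fin n} → i ≢ j → (j <ᶠ i) ≡ not (i <ᶠ j)
<ᶠ-flip {i = i} {j} i≢j with <-cmp (toℕ i) (toℕ j)
... | tri< i<j _ _ rewrite <ᶠ-true {i = i} {j} i<j = <ᶠ-false (<-asym i<j)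
... | tri≈ _ i≡j _ = ⊥-elim (i≢j (toℕ-injective i≡j))
... | tri> _ _ j<i rewrite <ᶠ-false {i = i} {j} (<-asym j<i) = <ᶠ-true j<i

∑∑ : (Fin n → Fin n → ℕ) → ℕ
∑∑ {n} F = ∑[ i < n ] ∑[ j < n ] F i j

∑< : (Fin n → Fin n → ℕ) → ℕ
∑< F = ∑∑ (λ i j → 𝟙 (i <ᶠ j) * F i j)

∑∑-cong : {F G : Fin n → Fin n → ℕ} → (∀ i j → F i j ≡ G i j) → ∑∑ F ≡ ∑∑ G
∑∑-cong F≡G = sum-cong-≗ (λ i → sum-cong-≗ (F≡G i))

∑∑-zero : ∑∑ {n} (λ _ _ → 0) ≡ 0
∑∑-zero {n} = trans (sum-cong-≗ {n} (λ _ → sum-replicate-zero n)) (sum-replicate-zero n)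

∑∑-+ : (F G : Fin n → Fin n → ℕ) → ∑∑ (λ i j → F i j + G i j) ≡ ∑∑ F + ∑∑ G
∑∑-+ F G = trans (sum-cong-≗ (λ i → ∑-distrib-+ (F i) (G i))) (∑-distrib-+ (λ i → sum (F i)) (λ i → sum (G i)))

∑∑-*ˡ : ∀ c (F : Fin n → Fin n → ℕ) → ∑∑ (λ i j → c * F i j) ≡ c * ∑∑ F
∑∑-*ˡ c F = trans (sum-cong-≗ (λ i → sym (*-distribˡ-sum c (F i)))) (sym (*-distribˡ-sum c (λ i → sum (F i))))

∑∑-permute : (π : Permutation′ n) (F : Fin n → Fin n → ℕ) → ∑∑ (λ i j → F (π ⟨$⟩ʳ i) (π ⟨$⟩ʳ j)) ≡ ∑∑ F
∑∑-permute π F = trans (sum-cong-≗ (λ i → sym (sum-permute (F (π ⟨$⟩ʳ i)) π)))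
                       (sym (sum-permute (λ i → sum (F i)) π))

∑∑-symmetric : (W : Fin n → Fin n → ℕ) → (∀ i j → W i j ≡ W j i) → (∀ i → W i i ≡ 0) → ∑∑ W ≡ 2 * ∑< W
∑∑-symmetric {n} W W-sym W-diag = begin
  ∑∑ W                           ≡⟨ ∑∑-cong split ⟩
  ∑∑ (λ i j → W< i j + W> i j)   ≡⟨ ∑∑-+ W< W> ⟩
  ∑< W + ∑∑ W>                   ≡⟨ cong (_+_ (∑< W)) (∑-comm {n} {n} W>) ⟩
  ∑< W + ∑∑ (λ j i → W> i j)     ≡⟨ cong (_+_ (∑< W)) (∑∑-cong (λ j i → cong (𝟙 (j <ᶠ i) *_) (W-sym i j))) ⟩
  ∑< W + ∑< W                    ≡⟨ cong (_+_ (∑< W)) (+-identityʳ (∑< W)) ⟨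
  2 * ∑< W                       ∎
  where
  open ≡-Reasoning
  W< W> : Fin n → Fin n → ℕ
  W< i j = 𝟙 (i <ᶠ j) * W i j
  W> i j = 𝟙 (j <ᶠ i) * W i j
  split : ∀ i j → W i j ≡ 𝟙 (i <ᶠ j) * W i j + 𝟙 (j <ᶠ i) * W i j
  split i j with i ≟ᶠ j
  ... | yes refl rewrite W-diag i | *-zeroʳ (𝟙 (i <ᶠ i)) = refl
  ... | no i≢j rewrite <ᶠ-flip i≢j with i <ᶠ j
  ...   | true = sym (trans (+-identityʳ _) (*-identityˡ _))
  ...   | false = sym (*-identityˡ _)

∑<-permute : (π : Permutation′ n) (W : Fin n → Fin n → ℕ) → (∀ i j → W i j ≡ W j i) → (∀ i → W i i ≡ 0) →
             ∑< (λ i j → W (π ⟨$⟩ʳ i) (π ⟨$⟩ʳ j)) ≡ ∑< W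
∑<-permute π W W-sym W-diag = *-cancelˡ-≡ _ _ 2 (begin
  2 * ∑< Wπ  ≡⟨ ∑∑-symmetric Wπ (λ i j → W-sym _ _) (λ i → W-diag _) ⟨
  ∑∑ Wπ      ≡⟨ ∑∑-permute π W ⟩
  ∑∑ W       ≡⟨ ∑∑-symmetric W W-sym W-diag ⟩
  2 * ∑< W   ∎)
  where
  open ≡-Reasoning
  Wπ = λ i j → W (π ⟨$⟩ʳ i) (π ⟨$⟩ʳ j)

-- Inversions and parity

inversionCount : (Fin n → Fin n) → ℕ
inversionCount f = ∑∑ (λ i j → 𝟙 (i <ᶠ j ∧ f j <ᶠ f i))

inversionCount-cong : ∀ {f g : Fin n → Fin n} → (∀ i → f i ≡ g i) → inversionCount f ≡ inversionCount g
inversionCount-cong f≗g = ∑∑-cong (λ i j → cong₂ (λ a b → 𝟙 (i <ᶠ j ∧ a <ᶠ b)) (f≗g j) (f≗g i))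

inversionCount-id : ∀ {n} → inversionCount {n} id ≡ 0
inversionCount-id {n} = trans (∑∑-cong no-inversion) (∑∑-zero {n})
  where
  no-inversion : ∀ (i j : Fin n) → 𝟙 (i <ᶠ j ∧ j <ᶠ i) ≡ 0
  no-inversion i j with i <ᶠ j in i<j
  ... | true = cong 𝟙 (<ᶠ-asym {i = i} {j} i<j)
  ... | false = refl

injective⇒surjective : ∀ {f : Fin n → Fin n} → Injective _≡_ _≡_ f → ∀ y → ∃ λ x → f x ≡ y
injective⇒surjective {suc n} {f} f-inj y with any? (λ x → f x ≟ᶠ y)
... | yes hit = hit
... | no miss = ⊥-elim (<-irrefl refl (injective⇒≤ punchOut-injective′))
  where
  y≢f : ∀ x → y ≢ f x
  y≢f x y≡fx = miss (x , sym y≡fx)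
  punchOut-injective′ : Injective _≡_ _≡_ (λ x → punchOut (y≢f x))
  punchOut-injective′ eq = f-inj (punchOut-injective (y≢f _) (y≢f _) eq)

injective⇒permutation : ∀ {f : Fin n → Fin n} → Injective _≡_ _≡_ f → Permutation′ n
injective⇒permutation {f = f} f-inj = permutation f (proj₁ ∘ surj) (proj₂ ∘ surj) (λ x → f-inj (proj₂ (surj (f x))))
  where surj = injective⇒surjective f-inj

⟨$⟩ʳ-injective : (π : Permutation′ n) → Injective _≡_ _≡_ (π ⟨$⟩ʳ_)
⟨$⟩ʳ-injective π eq = trans (sym (inverseˡ π)) (trans (cong (π ⟨$⟩ˡ_) eq) (inverseˡ π))

∘-injective : ∀ {f g : A → A} → Injective _≡_ _≡_ f → Injective _≡_ _≡_ g → Injective _≡_ _≡_ (f ∘ g)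
∘-injective f-inj g-inj = g-inj ∘ f-inj

discord : (Fin n → Fin n) → Fin n → Fin n → ℕ
discord f u v = 𝟙 ((v <ᶠ u) xor (f v <ᶠ f u))

discord-sym : ∀ {f : Fin n → Fin n} → Injective _≡_ _≡_ f → ∀ u v → discord f u v ≡ discord f v u
discord-sym {f = f} f-inj u v with u ≟ᶠ v
... | yes refl = refl
... | no u≢v rewrite <ᶠ-flip u≢v | <ᶠ-flip (u≢v ∘ f-inj) = cong 𝟙 (not-xor-not (u <ᶠ v) (f u <ᶠ f v))
  where
  not-xor-not : ∀ a b → not a xor not b ≡ a xor b
  not-xor-not true b = refl
  not-xor-not false b = not-involutive b

discord-diag : (f : Fin n → Fin n) → ∀ u → discord f u u ≡ 0
discord-diag f u rewrite <ᶠ-irrefl u | <ᶠ-irrefl (f u) = refl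

inversionCount≡∑<discord : (f : Fin n → Fin n) → inversionCount f ≡ ∑< (discord f)
inversionCount≡∑<discord f = ∑∑-cong pointwise
  where
  pointwise : ∀ i j → 𝟙 (i <ᶠ j ∧ f j <ᶠ f i) ≡ 𝟙 (i <ᶠ j) * discord f i j
  pointwise i j with i <ᶠ j in i<j
  ... | true rewrite <ᶠ-asym {i = i} {j} i<j = sym (+-identityʳ _)
  ... | false = refl

-- For i < j, f ∘ g and g together invert (i, j) as often as f inverts {g i, g j}, up to twice the pairs
-- inverted by both; summing, and reindexing by g, gives the identity.
inversionCount-∘ : ∀ {f : Fin n → Fin n} → Injective _≡_ _≡_ f → (π : Permutation′ n) →
                   ∃ λ K → inversionCount (f ∘ (π ⟨$⟩ʳ_)) + inversionCount (π ⟨$⟩ʳ_) ≡ inversionCount f + 2 * K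
inversionCount-∘ {n} {f} f-inj π = ∑∑ both , (begin
  inversionCount (f ∘ g) + inversionCount g
    ≡⟨ ∑∑-+ (λ i j → 𝟙 (i <ᶠ j ∧ f (g j) <ᶠ f (g i))) (λ i j → 𝟙 (i <ᶠ j ∧ g j <ᶠ g i)) ⟨
  ∑∑ (λ i j → 𝟙 (i <ᶠ j ∧ f (g j) <ᶠ f (g i)) + 𝟙 (i <ᶠ j ∧ g j <ᶠ g i))
    ≡⟨ ∑∑-cong (λ i j → split (i <ᶠ j) (g j <ᶠ g i) (f (g j) <ᶠ f (g i))) ⟩
  ∑∑ (λ i j → 𝟙 (i <ᶠ j) * discord f (g i) (g j) + 2 * both i j)
    ≡⟨ ∑∑-+ (λ i j → 𝟙 (i <ᶠ j) * discord f (g i) (g j)) (λ i j → 2 * both i j) ⟩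
  ∑< (λ i j → discord f (g i) (g j)) + ∑∑ (λ i j → 2 * both i j)
    ≡⟨ cong₂ _+_ (∑<-permute π (discord f) (discord-sym f-inj) (discord-diag f)) (∑∑-*ˡ 2 both) ⟩
  ∑< (discord f) + 2 * ∑∑ both
    ≡⟨ cong (_+ 2 * ∑∑ both) (inversionCount≡∑<discord f) ⟨
  inversionCount f + 2 * ∑∑ both ∎)
  where
  open ≡-Reasoning
  g = π ⟨$⟩ʳ_
  both : Fin n → Fin n → ℕ
  both i j = 𝟙 (i <ᶠ j ∧ g j <ᶠ g i ∧ f (g j) <ᶠ f (g i))
  split : ∀ a x y → 𝟙 (a ∧ y) + 𝟙 (a ∧ x) ≡ 𝟙 a * 𝟙 (x xor y) + 2 * 𝟙 (a ∧ x ∧ y)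
  split false x y = refl
  split true false false = refl
  split true false true = refl
  split true true false = refl
  split true true true = refl

odd : ℕ → Bool
odd zero = false
odd (suc n) = not (odd n)

odd-+ : ∀ m n → odd (m + n) ≡ odd m xor odd n
odd-+ zero n = refl
odd-+ (suc m) n = trans (cong not (odd-+ m n)) (not-distribˡ-xor (odd m) (odd n))

odd-2* : ∀ k → odd (2 * k) ≡ false
odd-2* k rewrite +-identityʳ k | odd-+ k k = xor-same (odd k)

xor-cancelʳ : ∀ a b {c} → a xor b ≡ c → a ≡ c xor b
xor-cancelʳ a b refl = sym (trans (xor-assoc a b b) (trans (cong (a xor_) (xor-same b)) (xor-identityʳ a)))

parity : (Fin n → Fin n) → Bool
parity f = odd (inversionCount f)

parity-∘ : ∀ {f g : Fin n → Fin n} → Injective _≡_ _≡_ f → Injective _≡_ _≡_ g →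
           parity (f ∘ g) ≡ parity f xor parity g
parity-∘ {f = f} {g} f-inj g-inj = xor-cancelʳ (parity (f ∘ g)) (parity g) (begin
  parity (f ∘ g) xor parity g                      ≡⟨ odd-+ (inversionCount (f ∘ g)) (inversionCount g) ⟨
  odd (inversionCount (f ∘ g) + inversionCount g)  ≡⟨ cong odd (proj₂ (inversionCount-∘ f-inj π)) ⟩
  odd (inversionCount f + 2 * K)                   ≡⟨ odd-+ (inversionCount f) (2 * K) ⟩
  parity f xor odd (2 * K)                         ≡⟨ cong (parity f xor_) (odd-2* K) ⟩
  parity f xor false                               ≡⟨ xor-identityʳ _ ⟩
  parity f                                         ∎)
  where
  open ≡-Reasoning
  π = injective⇒permutation g-inj
  K = proj₁ (inversionCount-∘ f-inj π)

conj : Permutation′ n → (Fin n → Fin n) → Fin n → Fin n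
conj π f = (π ⟨$⟩ʳ_) ∘ f ∘ (π ⟨$⟩ˡ_)

conj-injective : (π : Permutation′ n) {f : Fin n → Fin n} → Injective _≡_ _≡_ f → Injective _≡_ _≡_ (conj π f)
conj-injective π f-inj = ∘-injective (∘-injective (⟨$⟩ʳ-injective π) f-inj) (⟨$⟩ʳ-injective (Perm.flip π))

parity-conj : (π : Permutation′ n) {f : Fin n → Fin n} → Injective _≡_ _≡_ f → parity (conj π f) ≡ parity f
parity-conj {n} π {f} f-inj = begin
  parity (π⟨$⟩ ∘ f ∘ π⁻¹⟨$⟩)                      ≡⟨ parity-∘ (∘-injective π-inj f-inj) π⁻¹-inj ⟩
  parity (π⟨$⟩ ∘ f) xor parity π⁻¹⟨$⟩            ≡⟨ cong (_xor parity π⁻¹⟨$⟩) (parity-∘ π-inj f-inj) ⟩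
  (parity π⟨$⟩ xor parity f) xor parity π⁻¹⟨$⟩   ≡⟨ cong (_xor parity π⁻¹⟨$⟩) (xor-comm (parity π⟨$⟩) (parity f)) ⟩
  (parity f xor parity π⟨$⟩) xor parity π⁻¹⟨$⟩   ≡⟨ xor-assoc (parity f) _ _ ⟩
  parity f xor (parity π⟨$⟩ xor parity π⁻¹⟨$⟩)   ≡⟨ cong (parity f xor_) inverse-parities ⟩
  parity f xor false                             ≡⟨ xor-identityʳ _ ⟩
  parity f                                       ∎
  where
  open ≡-Reasoning
  π⟨$⟩ = π ⟨$⟩ʳ_
  π⁻¹⟨$⟩ = π ⟨$⟩ˡ_
  π-inj = ⟨$⟩ʳ-injective π
  π⁻¹-inj = ⟨$⟩ʳ-injective (Perm.flip π)
  inverse-parities : parity π⟨$⟩ xor parity π⁻¹⟨$⟩ ≡ false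
  inverse-parities = begin
    parity π⟨$⟩ xor parity π⁻¹⟨$⟩   ≡⟨ parity-∘ π-inj π⁻¹-inj ⟨
    parity (π⟨$⟩ ∘ π⁻¹⟨$⟩)          ≡⟨ cong odd (inversionCount-cong (λ _ → inverseʳ π)) ⟩
    odd (inversionCount {n} id)     ≡⟨ cong odd (inversionCount-id {n}) ⟩
    false                           ∎

-- Iterates and cycles

iterate : (A → A) → ℕ → A → A
iterate f zero x = x
iterate f (suc k) x = f (iterate f k x)

iterate-+ : (f : A → A) → ∀ a b x → iterate f (a + b) x ≡ iterate f a (iterate f b x)
iterate-+ f zero b x = refl
iterate-+ f (suc a) b x = cong f (iterate-+ f a b x)

iterate-comm : (f : A → A) → ∀ a b x → iterate f a (iterate f b x) ≡ iterate f b (iterate f a x)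
iterate-comm f a b x = begin
  iterate f a (iterate f b x) ≡⟨ iterate-+ f a b x ⟨
  iterate f (a + b) x         ≡⟨ cong (λ c → iterate f c x) (+-comm a b) ⟩
  iterate f (b + a) x         ≡⟨ iterate-+ f b a x ⟩
  iterate f b (iterate f a x) ∎
  where open ≡-Reasoning

iterate-natural : ∀ {f : A → A} {g : B → B} (φ : A → B) → (∀ x → φ (f x) ≡ g (φ x)) →
                  ∀ j x → φ (iterate f j x) ≡ iterate g j (φ x)
iterate-natural φ comm zero x = refl
iterate-natural {g = g} φ comm (suc j) x = trans (comm _) (cong g (iterate-natural φ comm j x))

iterate-cong : ∀ {f g : A → A} → (∀ x → f x ≡ g x) → ∀ j x → iterate f j x ≡ iterate g j x
iterate-cong = iterate-natural id

iterate-injective : ∀ {f : A → A} → Injective _≡_ _≡_ f → ∀ j → Injective _≡_ _≡_ (iterate f j)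
iterate-injective f-inj zero eq = eq
iterate-injective f-inj (suc j) eq = iterate-injective f-inj j (f-inj eq)

NoShortCycle : ℕ → (Fin n → Fin n) → Set
NoShortCycle t f = ∀ {j} → 0 < j → j ≤ t → ∀ i → iterate f j i ≢ i

ZeroOnCycleOfLength : ∀ {N} → ℕ → (Fin (suc N) → Fin (suc N)) → Set
ZeroOnCycleOfLength l f = iterate f l zero ≡ zero × (∀ {j} → 0 < j → j < l → iterate f j zero ≢ zero)

ZeroOnCycleOfLength-unique : ∀ {N l l'} {f : Fin (suc N) → Fin (suc N)} →
                             ZeroOnCycleOfLength (suc l) f → ZeroOnCycleOfLength l' f → suc l < l' → ⊥
ZeroOnCycleOfLength-unique (back , _) (_ , moves) l<l' = moves (s≤s z≤n) l<l' back

ZeroOnCycleOfLength-cong : ∀ {N l} {f g : Fin (suc N) → Fin (suc N)} → (∀ x → f x ≡ g x) →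
                           ZeroOnCycleOfLength l f → ZeroOnCycleOfLength l g
ZeroOnCycleOfLength-cong {l = l} f≗g (back , moves) =
  trans (sym (iterate-cong f≗g l zero)) back , λ {j} 0<j j<l eq → moves 0<j j<l (trans (iterate-cong f≗g j zero) eq)

iter≡iterate : (v : Vec (Fin n) n) → ∀ k i → iter v k i ≡ iterate (lookup v) k i
iter≡iterate v zero i = refl
iter≡iterate v (suc k) i = cong (lookup v) (iter≡iterate v k i)

isPermᵇ⇒injective : (v : Vec (Fin n) n) → T (isPermᵇ v) → Injective _≡_ _≡_ (lookup v)
isPermᵇ⇒injective {n} v perm {a} {b} va≡vb
  with Equivalence.to (T-∨ {a ==ᶠ b}) (all-all⁻ distinct (allFin n) (allFin n) perm (∈-allFin a) (∈-allFin b))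
  where
  distinct : Fin n → Fin n → Bool
  distinct i j = (i ==ᶠ j) ∨ not (lookup v i ==ᶠ lookup v j)
... | inj₁ a≡b = toWitness {a? = a ≟ᶠ b} a≡b
... | inj₂ va≢vb = ⊥-elim (toWitnessFalse {a? = lookup v a ≟ᶠ lookup v b} va≢vb va≡vb)

injective⇒isPermᵇ : (f : Fin n → Fin n) → Injective _≡_ _≡_ f → T (isPermᵇ (Vec.tabulate f))
injective⇒isPermᵇ {n} f f-inj = all-all⁺ distinct (allFin n) (allFin n) (λ {a} {b} _ _ → distinct? a b)
  where
  v = Vec.tabulate f
  distinct : Fin n → Fin n → Bool
  distinct i j = (i ==ᶠ j) ∨ not (lookup v i ==ᶠ lookup v j)
  distinct? : ∀ a b → T (distinct a b)
  distinct? a b with a ≟ᶠ b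
  ... | yes _ = tt
  ... | no a≢b = fromWitnessFalse {a? = lookup v a ≟ᶠ lookup v b}
                   (λ eq → a≢b (f-inj (trans (sym (lookup∘tabulate f a)) (trans eq (lookup∘tabulate f b)))))

noShortCycleᵇ⇒NoShortCycle : (v : Vec (Fin n) n) → T (noShortCycleᵇ t v) → NoShortCycle t (lookup v)
noShortCycleᵇ⇒NoShortCycle {n} {t} v ok {suc j} _ j<t i fixed =
  toWitnessFalse {a? = iter v (suc j) i ≟ᶠ i} (all-all⁻ moves (allFin n) (upTo t) ok (∈-allFin i) (∈-upTo⁺ j<t))
                 (trans (iter≡iterate v (suc j) i) fixed)
  where
  moves : Fin n → ℕ → Bool
  moves i k = not (iter v (suc k) i ==ᶠ i)

NoShortCycle⇒noShortCycleᵇ : (f : Fin n → Fin n) → NoShortCycle t f → T (noShortCycleᵇ t (Vec.tabulate f))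
NoShortCycle⇒noShortCycleᵇ {n} {t} f ok = all-all⁺ moves (allFin n) (upTo t) (λ {i} {j} _ j∈ →
  fromWitnessFalse {a? = iter v (suc j) i ≟ᶠ i}
    (λ fixed → ok (s≤s z≤n) (∈-upTo⁻ j∈) i (trans (sym (iterate-tabulate (suc j) i)) fixed)))
  where
  v = Vec.tabulate f
  moves : Fin n → ℕ → Bool
  moves i k = not (iter v (suc k) i ==ᶠ i)
  iterate-tabulate : ∀ k i → iter v k i ≡ iterate f k i
  iterate-tabulate k i = trans (iter≡iterate v k i) (iterate-cong (lookup∘tabulate f) k i)

length-filterᵇ-∷ : (P : A → Bool) (x : A) (xs : List A) →
                   length (filterᵇ P (x ∷ xs)) ≡ 𝟙 (P x) + length (filterᵇ P xs)
length-filterᵇ-∷ P x xs with P x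
... | true = refl
... | false = refl

length-filterᵇ-++ : (P : A → Bool) (xs ys : List A) →
                    length (filterᵇ P (xs ++ ys)) ≡ length (filterᵇ P xs) + length (filterᵇ P ys)
length-filterᵇ-++ P xs ys = trans (cong length (filter-++ (T? ∘ P) xs ys)) (length-++ (filterᵇ P xs))

length-filterᵇ-map : (P : B → Bool) (g : A → B) (xs : List A) →
                     length (filterᵇ P (map g xs)) ≡ length (filterᵇ (P ∘ g) xs)
length-filterᵇ-map P g [] = refl
length-filterᵇ-map P g (x ∷ xs) = begin
  length (filterᵇ P (g x ∷ map g xs))          ≡⟨ length-filterᵇ-∷ P (g x) (map g xs) ⟩
  𝟙 (P (g x)) + length (filterᵇ P (map g xs))  ≡⟨ cong (_+_ (𝟙 (P (g x)))) (length-filterᵇ-map P g xs) ⟩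
  𝟙 (P (g x)) + length (filterᵇ (P ∘ g) xs)    ≡⟨ length-filterᵇ-∷ (P ∘ g) x xs ⟨
  length (filterᵇ (P ∘ g) (x ∷ xs))            ∎
  where open ≡-Reasoning

length-filterᵇ-cartesianProductWith :
  ∀ {C : Set} (P : C → Bool) (f : A → B → C) (g : Fin n → A) (ys : List B) →
  length (filterᵇ P (cartesianProductWith f (tabulate g) ys)) ≡ ∑[ i < n ] length (filterᵇ (P ∘ f (g i)) ys)
length-filterᵇ-cartesianProductWith {n = zero} P f g ys = refl
length-filterᵇ-cartesianProductWith {n = suc n} P f g ys =
  trans (length-filterᵇ-++ P (map (f (g zero)) ys) _)
        (cong₂ _+_ (length-filterᵇ-map P (f (g zero)) ys) (length-filterᵇ-cartesianProductWith P f (g ∘ suc) ys))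

inversions≡inversionCount : (v : Vec (Fin n) n) → inversions v ≡ inversionCount (lookup v)
inversions≡inversionCount {n} v = begin
  length (filterᵇ inverted (allVecs n 2))
    ≡⟨ cong (length ∘ filterᵇ inverted)
            (trans (allVecs-suc n 1) (cong (cartesianProductWith _∷_ (allFin n)) (allVecs-suc n 0))) ⟩
  length (filterᵇ inverted (cartesianProductWith _∷_ (tabulate id) (cartesianProductWith _∷_ (tabulate id) [ [] ])))
    ≡⟨ length-filterᵇ-cartesianProductWith inverted _∷_ id _ ⟩
  ∑[ i < n ] length (filterᵇ (λ p → inverted (i ∷ p)) (cartesianProductWith _∷_ (tabulate id) [ [] ]))
    ≡⟨ sum-cong-≗ (λ i → trans (length-filterᵇ-cartesianProductWith (λ p → inverted (i ∷ p)) _∷_ id _)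
                               (sum-cong-≗ (λ j → length-filterᵇ-∷ (λ p → inverted (i ∷ j ∷ p)) [] []))) ⟩
  ∑∑ (λ i j → 𝟙 (inverted (i ∷ j ∷ [])) + 0)
    ≡⟨ ∑∑-cong (λ i j → +-identityʳ (𝟙 (inverted (i ∷ j ∷ [])))) ⟩
  inversionCount (lookup v) ∎
  where
  open ≡-Reasoning
  inverted : Vec (Fin n) 2 → Bool
  inverted p = lookup p zero <ᶠ lookup p (suc zero) ∧ lookup v (lookup p (suc zero)) <ᶠ lookup v (lookup p zero)

even?≡not-odd : ∀ m → ((m % 2) ≡ᵇ 0) ≡ not (odd m)
even?≡not-odd zero = refl
even?≡not-odd (suc zero) = refl
even?≡not-odd (suc (suc m)) = trans (even?≡not-odd m) (sym (not-involutive (not (odd m))))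

isEvenᵇ≡not-parity : (v : Vec (Fin n) n) → isEvenᵇ v ≡ not (parity (lookup v))
isEvenᵇ≡not-parity v = trans (even?≡not-odd (inversions v)) (cong (not ∘ odd) (inversions≡inversionCount v))

rotate : Fin (suc k) → Fin (suc k)
rotate {k} zero = fromℕ k
rotate {suc k} (suc i) = inject₁ i

rotate-injective : Injective _≡_ _≡_ (rotate {k})
rotate-injective {k} {zero} {zero} _ = refl
rotate-injective {suc k} {zero} {suc j} eq = ⊥-elim (fromℕ≢inject₁ eq)
rotate-injective {suc k} {suc i} {zero} eq = ⊥-elim (fromℕ≢inject₁ (sym eq))
rotate-injective {suc k} {suc i} {suc j} eq = cong suc (inject₁-injective eq)

toℕ-rotate : (y : Fin (suc k)) → 0 < toℕ y → toℕ (rotate y) ≡ pred (toℕ y)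
toℕ-rotate {suc k} (suc i) _ = toℕ-inject₁ i

toℕ-iterate-rotate : (y : Fin (suc k)) → ∀ j → j ≤ toℕ y → toℕ (iterate rotate j y) ≡ toℕ y ∸ j
toℕ-iterate-rotate y zero _ = refl
toℕ-iterate-rotate y (suc j) j<y = begin
  toℕ (rotate (iterate rotate j y)) ≡⟨ toℕ-rotate _ (subst (0 <_) (sym IH) (m<n⇒0<n∸m j<y)) ⟩
  pred (toℕ (iterate rotate j y))   ≡⟨ cong pred IH ⟩
  pred (toℕ y ∸ j)                  ≡⟨ pred[m∸n]≡m∸[1+n] (toℕ y) j ⟩
  toℕ y ∸ suc j                     ∎
  where
  open ≡-Reasoning
  IH = toℕ-iterate-rotate y j (<⇒≤ j<y)

toℕ-iterate-rotate-zero : ∀ j → j ≤ k → toℕ (iterate rotate (suc j) (zero {k})) ≡ k ∸ j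
toℕ-iterate-rotate-zero {k} j j≤k = begin
  toℕ (iterate rotate (suc j) zero) ≡⟨ cong (λ c → toℕ (iterate (rotate {k}) c zero)) (+-comm 1 j) ⟩
  toℕ (iterate rotate (j + 1) zero) ≡⟨ cong toℕ (iterate-+ rotate j 1 zero) ⟩
  toℕ (iterate rotate j (fromℕ k))  ≡⟨ toℕ-iterate-rotate (fromℕ k) j (subst (j ≤_) (sym (toℕ-fromℕ k)) j≤k) ⟩
  toℕ (fromℕ k) ∸ j                 ≡⟨ cong (_∸ j) (toℕ-fromℕ k) ⟩
  k ∸ j                             ∎
  where open ≡-Reasoning

rotate-cycle : iterate rotate (suc k) (zero {k}) ≡ zero
rotate-cycle {k} = toℕ-injective (trans (toℕ-iterate-rotate-zero k ≤-refl) (n∸n≡0 k))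

rotate-reach : (y : Fin (suc k)) → iterate rotate (suc (k ∸ toℕ y)) zero ≡ y
rotate-reach {k} y = toℕ-injective (trans (toℕ-iterate-rotate-zero (k ∸ toℕ y) (m∸n≤m k (toℕ y)))
                                           (m∸[m∸n]≡n (s≤s⁻¹ (toℕ<n y))))

rotate-moves-zero : ∀ {j} → 0 < j → j ≤ k → iterate rotate j (zero {k}) ≢ zero
rotate-moves-zero {k} {suc j} _ j<k eq =
  <⇒≢ (m<n⇒0<n∸m j<k) (sym (trans (sym (toℕ-iterate-rotate-zero j (<⇒≤ j<k))) (cong toℕ eq)))

-- Every point is an iterate of 0 and iterates of rotate commute, so a point fixed by an iterate forces 0 to be.
rotate-noShortCycle : t ≤ k → NoShortCycle t (rotate {k})
rotate-noShortCycle {t} {k} t≤k {j} 0<j j≤t y fixed =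
  rotate-moves-zero 0<j (≤-trans j≤t t≤k) (iterate-injective rotate-injective r (begin
  iterate rotate r (iterate rotate j zero) ≡⟨ iterate-comm rotate r j zero ⟩
  iterate rotate j (iterate rotate r zero) ≡⟨ cong (iterate rotate j) (rotate-reach y) ⟩
  iterate rotate j y                       ≡⟨ fixed ⟩
  y                                        ≡⟨ rotate-reach y ⟨
  iterate rotate r zero                    ∎))
  where
  open ≡-Reasoning
  r = suc (k ∸ toℕ y)

inversionCount-rotate : ∀ k → inversionCount (rotate {k}) ≡ k
inversionCount-rotate zero = refl
inversionCount-rotate (suc k) =
  trans (cong₂ _+_ first-row (trans (sum-cong-≗ other-rows) (sum-replicate-zero (suc k)))) (+-identityʳ (suc k))
  where
  ∑-ones : ∀ n → ∑[ i < n ] 1 ≡ n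
  ∑-ones zero = refl
  ∑-ones (suc n) = cong suc (∑-ones n)
  below-top : (j : Fin (suc k)) → (inject₁ j <ᶠ fromℕ (suc k)) ≡ true
  below-top j = <ᶠ-true (subst₂ _<_ (sym (toℕ-inject₁ j)) (sym (toℕ-fromℕ (suc k))) (toℕ<n j))
  first-row : ∑[ j < suc k ] 𝟙 (zero <ᶠ suc j ∧ inject₁ j <ᶠ fromℕ (suc k)) ≡ suc k
  first-row = trans (sum-cong-≗ (λ j → cong 𝟙 (below-top j))) (∑-ones (suc k))
  other-rows : ∀ (i : Fin (suc k)) → ∑[ j < suc (suc k) ] 𝟙 (suc i <ᶠ j ∧ rotate j <ᶠ inject₁ i) ≡ 0
  other-rows i = trans (sum-cong-≗ {suc k} no-inversion) (sum-replicate-zero (suc k))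
    where
    no-inversion : ∀ j → 𝟙 (i <ᶠ j ∧ inject₁ j <ᶠ inject₁ i) ≡ 0
    no-inversion j with i <ᶠ j in i<j
    ... | false = refl
    ... | true = cong 𝟙 (trans (cong₂ _<ᵇ_ (toℕ-inject₁ j) (toℕ-inject₁ i)) (<ᶠ-asym {i = i} {j} i<j))

-- Direct sums and relabellings

_⊕_ : ∀ {a b} → (Fin a → Fin a) → (Fin b → Fin b) → Fin (a + b) → Fin (a + b)
_⊕_ {a} {b} f g = [ (_↑ˡ b) ∘ f , (a ↑ʳ_) ∘ g ]′ ∘ splitAt a

data SplitView (a b : ℕ) : Fin (a + b) → Set where
  left  : (i : Fin a) → SplitView a b (i ↑ˡ b)
  right : (j : Fin b) → SplitView a b (a ↑ʳ j)

splitView : ∀ a {b} (x : Fin (a + b)) → SplitView a b x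
splitView a {b} x with splitAt a x in eq
... | inj₁ i = subst (SplitView a b) (splitAt⁻¹-↑ˡ eq) (left i)
... | inj₂ j = subst (SplitView a b) (splitAt⁻¹-↑ʳ eq) (right j)

↑ˡ≢↑ʳ : ∀ {a b} (i : Fin a) (j : Fin b) → i ↑ˡ b ≢ a ↑ʳ j
↑ˡ≢↑ʳ {a} {b} i j eq with trans (sym (splitAt-↑ˡ a i b)) (trans (cong (splitAt a) eq) (splitAt-↑ʳ a b j))
... | ()

module _ {a b} (f : Fin a → Fin a) (g : Fin b → Fin b) where

  ⊕-↑ˡ : ∀ i → (f ⊕ g) (i ↑ˡ b) ≡ f i ↑ˡ b
  ⊕-↑ˡ i rewrite splitAt-↑ˡ a i b = refl

  ⊕-↑ʳ : ∀ j → (f ⊕ g) (a ↑ʳ j) ≡ a ↑ʳ g j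
  ⊕-↑ʳ j rewrite splitAt-↑ʳ a b j = refl

  iterate-⊕-↑ˡ : ∀ k i → iterate (f ⊕ g) k (i ↑ˡ b) ≡ iterate f k i ↑ˡ b
  iterate-⊕-↑ˡ k i = sym (iterate-natural (_↑ˡ b) (λ i → sym (⊕-↑ˡ i)) k i)

  iterate-⊕-↑ʳ : ∀ k j → iterate (f ⊕ g) k (a ↑ʳ j) ≡ a ↑ʳ iterate g k j
  iterate-⊕-↑ʳ k j = sym (iterate-natural (a ↑ʳ_) (λ j → sym (⊕-↑ʳ j)) k j)

  ⊕-injective : Injective _≡_ _≡_ f → Injective _≡_ _≡_ g → Injective _≡_ _≡_ (f ⊕ g)
  ⊕-injective f-inj g-inj {x} {y} eq with splitView a x | splitView a y
  ... | left i | left i' = cong (_↑ˡ b) (f-inj (↑ˡ-injective b _ _ (trans (sym (⊕-↑ˡ i)) (trans eq (⊕-↑ˡ i')))))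
  ... | left i | right j' = ⊥-elim (↑ˡ≢↑ʳ _ _ (trans (sym (⊕-↑ˡ i)) (trans eq (⊕-↑ʳ j'))))
  ... | right j | left i' = ⊥-elim (↑ˡ≢↑ʳ _ _ (trans (sym (⊕-↑ˡ i')) (trans (sym eq) (⊕-↑ʳ j))))
  ... | right j | right j' = cong (a ↑ʳ_) (g-inj (↑ʳ-injective a _ _ (trans (sym (⊕-↑ʳ j)) (trans eq (⊕-↑ʳ j')))))

  ⊕-noShortCycle : NoShortCycle t f → NoShortCycle t g → NoShortCycle t (f ⊕ g)
  ⊕-noShortCycle f-ok g-ok {k} 0<k k≤t x fixed with splitView a x
  ... | left i = f-ok 0<k k≤t i (↑ˡ-injective b _ _ (trans (sym (iterate-⊕-↑ˡ k i)) fixed))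
  ... | right j = g-ok 0<k k≤t j (↑ʳ-injective a _ _ (trans (sym (iterate-⊕-↑ʳ k j)) fixed))

  private
    sum-↑ : (φ : Fin (a + b) → ℕ) → sum φ ≡ ∑[ i < a ] φ (i ↑ˡ b) + ∑[ j < b ] φ (a ↑ʳ j)
    sum-↑ = go a
      where
      go : ∀ a (φ : Fin (a + b) → ℕ) → sum φ ≡ ∑[ i < a ] φ (i ↑ˡ b) + ∑[ j < b ] φ (a ↑ʳ j)
      go zero φ = refl
      go (suc a) φ = trans (cong (_+_ (φ zero)) (go a (φ ∘ suc))) (sym (+-assoc (φ zero) _ _))

    <ᶠ-↑ˡ : ∀ (i i' : Fin a) → (i ↑ˡ b) <ᶠ (i' ↑ˡ b) ≡ i <ᶠ i'
    <ᶠ-↑ˡ i i' = cong₂ _<ᵇ_ (toℕ-↑ˡ i b) (toℕ-↑ˡ i' b)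

    <ᶠ-↑ʳ : ∀ (j j' : Fin b) → (a ↑ʳ j) <ᶠ (a ↑ʳ j') ≡ j <ᶠ j'
    <ᶠ-↑ʳ j j' = trans (cong₂ _<ᵇ_ (toℕ-↑ʳ a j) (toℕ-↑ʳ a j')) (+-<ᵇ-+ a)
      where
      +-<ᵇ-+ : ∀ c → (c + toℕ j <ᵇ c + toℕ j') ≡ (j <ᶠ j')
      +-<ᵇ-+ zero = refl
      +-<ᵇ-+ (suc c) = +-<ᵇ-+ c

    ↑ˡ<ᶠ↑ʳ : ∀ (i : Fin a) (j : Fin b) → (i ↑ˡ b) <ᶠ (a ↑ʳ j) ≡ true
    ↑ˡ<ᶠ↑ʳ i j = <ᶠ-true (subst₂ _<_ (sym (toℕ-↑ˡ i b)) (sym (toℕ-↑ʳ a j)) (≤-trans (toℕ<n i) (m≤m+n a (toℕ j))))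

    Inv : Fin (a + b) → Fin (a + b) → ℕ
    Inv x y = 𝟙 (x <ᶠ y ∧ (f ⊕ g) y <ᶠ (f ⊕ g) x)

    row-↑ˡ : ∀ i → ∑[ y < a + b ] Inv (i ↑ˡ b) y ≡ ∑[ i' < a ] 𝟙 (i <ᶠ i' ∧ f i' <ᶠ f i)
    row-↑ˡ i = begin
      ∑[ y < a + b ] Inv (i ↑ˡ b) y
        ≡⟨ sum-↑ (Inv (i ↑ˡ b)) ⟩
      ∑[ i' < a ] Inv (i ↑ˡ b) (i' ↑ˡ b) + ∑[ j < b ] Inv (i ↑ˡ b) (a ↑ʳ j)
        ≡⟨ cong₂ _+_ (sum-cong-≗ left-left) (trans (sum-cong-≗ left-right) (sum-replicate-zero b)) ⟩
      ∑[ i' < a ] 𝟙 (i <ᶠ i' ∧ f i' <ᶠ f i) + 0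
        ≡⟨ +-identityʳ _ ⟩
      ∑[ i' < a ] 𝟙 (i <ᶠ i' ∧ f i' <ᶠ f i) ∎
      where
      open ≡-Reasoning
      left-left : ∀ i' → Inv (i ↑ˡ b) (i' ↑ˡ b) ≡ 𝟙 (i <ᶠ i' ∧ f i' <ᶠ f i)
      left-left i' rewrite ⊕-↑ˡ i | ⊕-↑ˡ i' | <ᶠ-↑ˡ i i' | <ᶠ-↑ˡ (f i') (f i) = refl
      left-right : ∀ j → Inv (i ↑ˡ b) (a ↑ʳ j) ≡ 0
      left-right j rewrite ⊕-↑ˡ i | ⊕-↑ʳ j | <ᶠ-asym {i = f i ↑ˡ b} {a ↑ʳ g j} (↑ˡ<ᶠ↑ʳ (f i) (g j)) =
        cong 𝟙 (∧-zeroʳ _)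

    row-↑ʳ : ∀ j → ∑[ y < a + b ] Inv (a ↑ʳ j) y ≡ ∑[ j' < b ] 𝟙 (j <ᶠ j' ∧ g j' <ᶠ g j)
    row-↑ʳ j = begin
      ∑[ y < a + b ] Inv (a ↑ʳ j) y
        ≡⟨ sum-↑ (Inv (a ↑ʳ j)) ⟩
      ∑[ i < a ] Inv (a ↑ʳ j) (i ↑ˡ b) + ∑[ j' < b ] Inv (a ↑ʳ j) (a ↑ʳ j')
        ≡⟨ cong₂ _+_ (trans (sum-cong-≗ right-left) (sum-replicate-zero a)) (sum-cong-≗ right-right) ⟩
      0 + ∑[ j' < b ] 𝟙 (j <ᶠ j' ∧ g j' <ᶠ g j) ∎
      where
      open ≡-Reasoning
      right-left : ∀ i → Inv (a ↑ʳ j) (i ↑ˡ b) ≡ 0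
      right-left i rewrite <ᶠ-asym {i = i ↑ˡ b} {a ↑ʳ j} (↑ˡ<ᶠ↑ʳ i j) = refl
      right-right : ∀ j' → Inv (a ↑ʳ j) (a ↑ʳ j') ≡ 𝟙 (j <ᶠ j' ∧ g j' <ᶠ g j)
      right-right j' rewrite ⊕-↑ʳ j | ⊕-↑ʳ j' | <ᶠ-↑ʳ j j' | <ᶠ-↑ʳ (g j') (g j) = refl

  inversionCount-⊕ : inversionCount (f ⊕ g) ≡ inversionCount f + inversionCount g
  inversionCount-⊕ = trans (sum-↑ (λ x → ∑[ y < a + b ] Inv x y)) (cong₂ _+_ (sum-cong-≗ row-↑ˡ) (sum-cong-≗ row-↑ʳ))

module _ (π : Permutation′ n) (f : Fin n → Fin n) where

  iterate-conj : ∀ j x → iterate (conj π f) j x ≡ π ⟨$⟩ʳ iterate f j (π ⟨$⟩ˡ x)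
  iterate-conj j x = begin
    iterate (conj π f) j x                    ≡⟨ cong (iterate (conj π f) j) (inverseʳ π) ⟨
    iterate (conj π f) j (π ⟨$⟩ʳ (π ⟨$⟩ˡ x))  ≡⟨ iterate-natural (π ⟨$⟩ʳ_) conj-π j _ ⟨
    π ⟨$⟩ʳ iterate f j (π ⟨$⟩ˡ x)             ∎
    where
    open ≡-Reasoning
    conj-π : ∀ y → π ⟨$⟩ʳ f y ≡ conj π f (π ⟨$⟩ʳ y)
    conj-π y = cong ((π ⟨$⟩ʳ_) ∘ f) (sym (inverseˡ π))

  conj-noShortCycle : NoShortCycle t f → NoShortCycle t (conj π f)
  conj-noShortCycle f-ok {j} 0<j j≤t x fixed = f-ok 0<j j≤t (π ⟨$⟩ˡ x)
    (⟨$⟩ʳ-injective π (trans (sym (iterate-conj j x)) (trans fixed (sym (inverseʳ π)))))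

Choice : ℕ → ℕ → Set
Choice zero m = ⊤
Choice (suc k) m = Choice k m × Fin (suc (k + m))

-- A choice fixes, one after the other, where each of the first k points is sent.
relabel : Choice k m → Permutation′ (k + m)
relabel {zero} _ = Perm.id
relabel {suc k} (c , p) = lift₀ (relabel c) ∘ₚ transpose zero p

relabel-determined : ∀ {c c' : Choice k m} → (∀ i → relabel c ⟨$⟩ʳ (i ↑ˡ m) ≡ relabel c' ⟨$⟩ʳ (i ↑ˡ m)) → c ≡ c'
relabel-determined {zero} _ = refl
relabel-determined {suc k} {c = c , p} {c' , p'} agree with agree zero
... | refl = cong (_, p) (relabel-determined (λ i →
  suc-injective (⟨$⟩ʳ-injective (transpose zero p) (agree (suc i)))))

allChoices : ∀ k m → List (Choice k m)
allChoices zero m = [ tt ]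
allChoices (suc k) m = cartesianProductWith _,_ (allChoices k m) (allFin (suc (k + m)))

allChoices-unique : ∀ k m → Unique (allChoices k m)
allChoices-unique zero m = [] ∷ []
allChoices-unique (suc k) m = cartesianProductWith⁺ _,_ (λ { refl → refl , refl }) (allChoices-unique k m) (allFin⁺ _)

length-allChoices : ∀ k m → length (allChoices k m) * m ! ≡ (k + m) !
length-allChoices zero m = +-identityʳ (m !)
length-allChoices (suc k) m = begin
  length (allChoices (suc k) m) * m !  ≡⟨ cong (_* m !) length-allChoices-suc ⟩
  L * suc (k + m) * m !                ≡⟨ swap L (suc (k + m)) (m !) ⟩
  L * m ! * suc (k + m)                ≡⟨ cong (_* suc (k + m)) (length-allChoices k m) ⟩
  (k + m) ! * suc (k + m)              ≡⟨ *-comm ((k + m) !) _ ⟩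
  suc (k + m) !                        ∎
  where
  open ≡-Reasoning
  L = length (allChoices k m)
  length-allChoices-suc : length (allChoices (suc k) m) ≡ L * suc (k + m)
  length-allChoices-suc = trans (length-cartesianProductWith _,_ (allChoices k m) (allFin (suc (k + m))))
                                (cong (L *_) (length-tabulate id))
  swap : ∀ a b c → a * b * c ≡ a * c * b
  swap = solve-∀

cyclePerm : Choice k m → (Fin m → Fin m) → Fin (suc (k + m)) → Fin (suc (k + m))
cyclePerm c σ = conj (lift₀ (relabel c)) (rotate ⊕ σ)

module _ {k m} (c : Choice k m) (σ : Fin m → Fin m) where

  private
    τ : Permutation′ (suc (k + m))
    τ = lift₀ (relabel c)
    h : Fin (suc (k + m)) → Fin (suc (k + m))
    h = rotate ⊕ σ
    h-injective : Injective _≡_ _≡_ σ → Injective _≡_ _≡_ h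
    h-injective = ⊕-injective rotate σ rotate-injective

  cyclePerm-injective : Injective _≡_ _≡_ σ → Injective _≡_ _≡_ (cyclePerm c σ)
  cyclePerm-injective σ-inj = conj-injective τ (h-injective σ-inj)

  parity-cyclePerm : Injective _≡_ _≡_ σ → parity (cyclePerm c σ) ≡ odd k xor parity σ
  parity-cyclePerm σ-inj = begin
    parity (cyclePerm c σ)                                ≡⟨ parity-conj τ (h-injective σ-inj) ⟩
    odd (inversionCount h)                                ≡⟨ cong odd (inversionCount-⊕ (rotate {k}) σ) ⟩
    odd (inversionCount (rotate {k}) + inversionCount σ)  ≡⟨ odd-+ (inversionCount (rotate {k})) _ ⟩
    odd (inversionCount (rotate {k})) xor parity σ        ≡⟨ cong (λ x → odd x xor parity σ) (inversionCount-rotate k) ⟩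
    odd k xor parity σ                                    ∎
    where open ≡-Reasoning

  cyclePerm-noShortCycle : t ≤ k → NoShortCycle t σ → NoShortCycle t (cyclePerm c σ)
  cyclePerm-noShortCycle t≤k σ-ok = conj-noShortCycle τ h (⊕-noShortCycle rotate σ (rotate-noShortCycle t≤k) σ-ok)

  cyclePerm-relabel : ∀ x → cyclePerm c σ (τ ⟨$⟩ʳ x) ≡ τ ⟨$⟩ʳ h x
  cyclePerm-relabel x = cong ((τ ⟨$⟩ʳ_) ∘ h) (inverseˡ τ {x})

  cyclePerm-zeroCycle : ZeroOnCycleOfLength (suc k) (cyclePerm c σ)
  cyclePerm-zeroCycle = back , moves
    where
    iterate-zero : ∀ j → iterate (cyclePerm c σ) j zero ≡ τ ⟨$⟩ʳ (iterate rotate j zero ↑ˡ m)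
    iterate-zero j = trans (iterate-conj τ h j zero) (cong (τ ⟨$⟩ʳ_) (iterate-⊕-↑ˡ rotate σ j zero))
    back : iterate (cyclePerm c σ) (suc k) zero ≡ zero
    back = trans (iterate-zero (suc k)) (cong (λ y → τ ⟨$⟩ʳ (y ↑ˡ m)) rotate-cycle)
    moves : ∀ {j} → 0 < j → j < suc k → iterate (cyclePerm c σ) j zero ≢ zero
    moves {j} 0<j (s≤s j≤k) eq =
      rotate-moves-zero 0<j j≤k (↑ˡ-injective m _ _ (⟨$⟩ʳ-injective τ (trans (sym (iterate-zero j)) eq)))

-- τ'⁻¹ ∘ τ intertwines rotate ⊕ σ with rotate ⊕ σ' and fixes 0, hence fixes the cycle through 0; so τ and τ'
-- agree on the first k + 1 points, which determines the choice.
cyclePerm-determines : ∀ {c c' : Choice k m} {σ σ'} → (∀ x → cyclePerm c σ x ≡ cyclePerm c' σ' x) →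
                       c ≡ c' × (∀ z → σ z ≡ σ' z)
cyclePerm-determines {k} {m} {c} {c'} {σ} {σ'} same = c≡c' , σ≗σ' c≡c'
  where
  τ = lift₀ (relabel c)
  τ' = lift₀ (relabel c')
  φ : Fin (suc (k + m)) → Fin (suc (k + m))
  φ x = τ' ⟨$⟩ˡ (τ ⟨$⟩ʳ x)
  φ-comm : ∀ x → φ ((rotate ⊕ σ) x) ≡ (rotate ⊕ σ') (φ x)
  φ-comm x = begin
    τ' ⟨$⟩ˡ (τ ⟨$⟩ʳ (rotate ⊕ σ) x)          ≡⟨ cong (τ' ⟨$⟩ˡ_) (cyclePerm-relabel c σ x) ⟨
    τ' ⟨$⟩ˡ cyclePerm c σ (τ ⟨$⟩ʳ x)          ≡⟨ cong (τ' ⟨$⟩ˡ_) (same (τ ⟨$⟩ʳ x)) ⟩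
    τ' ⟨$⟩ˡ cyclePerm c' σ' (τ ⟨$⟩ʳ x)        ≡⟨ inverseˡ τ' ⟩
    (rotate ⊕ σ') (φ x)                      ∎
    where open ≡-Reasoning
  φ-fixes-cycle : ∀ (y : Fin (suc k)) → φ (y ↑ˡ m) ≡ y ↑ˡ m
  φ-fixes-cycle y = begin
    φ (y ↑ˡ m)                               ≡⟨ cong (λ (w : Fin (suc k)) → φ (w ↑ˡ m)) (rotate-reach y) ⟨
    φ (iterate rotate r zero ↑ˡ m)           ≡⟨ cong φ (iterate-⊕-↑ˡ (rotate {k}) σ r zero) ⟨
    φ (iterate (rotate ⊕ σ) r zero)          ≡⟨ iterate-natural {g = rotate ⊕ σ'} φ φ-comm r zero ⟩
    iterate (rotate ⊕ σ') r zero             ≡⟨ iterate-⊕-↑ˡ (rotate {k}) σ' r zero ⟩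
    iterate rotate r zero ↑ˡ m               ≡⟨ cong (_↑ˡ m) (rotate-reach y) ⟩
    y ↑ˡ m                                   ∎
    where
    open ≡-Reasoning
    r = suc (k ∸ toℕ y)
  c≡c' : c ≡ c'
  c≡c' = relabel-determined (λ i →
    suc-injective (trans (sym (inverseʳ τ')) (cong (τ' ⟨$⟩ʳ_) (φ-fixes-cycle (suc i)))))
  σ≗σ' : c ≡ c' → ∀ z → σ z ≡ σ' z
  σ≗σ' refl z = ↑ʳ-injective (suc k) _ _ (begin
    suc k ↑ʳ σ z                ≡⟨ ⊕-↑ʳ rotate σ z ⟨
    (rotate ⊕ σ) (suc k ↑ʳ z)   ≡⟨ ⟨$⟩ʳ-injective τ same-image ⟩
    (rotate ⊕ σ') (suc k ↑ʳ z)  ≡⟨ ⊕-↑ʳ rotate σ' z ⟩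
    suc k ↑ʳ σ' z               ∎)
    where
    open ≡-Reasoning
    x = suc k ↑ʳ z
    same-image : τ ⟨$⟩ʳ (rotate ⊕ σ) x ≡ τ ⟨$⟩ʳ (rotate ⊕ σ') x
    same-image = trans (sym (cyclePerm-relabel c σ x)) (trans (same (τ ⟨$⟩ʳ x)) (cyclePerm-relabel c σ' x))

-- Counting by the cycle through 0

-- o is the required parity (true: odd), so that E n t = #good t false n and O n t = #good t true n.
Goodᵇ : ℕ → Bool → Vec (Fin n) n → Bool
Goodᵇ t o v = isPermᵇ v ∧ (o xor isEvenᵇ v) ∧ noShortCycleᵇ t v

good : ℕ → Bool → (n : ℕ) → List (Vec (Fin n) n)
good t o n = filterᵇ (Goodᵇ t o) (allVecs n n)

#good : ℕ → Bool → ℕ → ℕ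
#good t o n = countVecs n (Goodᵇ t o)

Goodᵇ⇒ : ∀ {o} (v : Vec (Fin n) n) → T (Goodᵇ t o v) →
         Injective _≡_ _≡_ (lookup v) × parity (lookup v) ≡ o × NoShortCycle t (lookup v)
Goodᵇ⇒ {o = o} v ok with Equivalence.to T-∧ ok
... | perm , rest with Equivalence.to (T-∧ {o xor isEvenᵇ v}) rest
...   | right-parity , no-short =
  isPermᵇ⇒injective v perm , parity≡ o (subst (T ∘ (o xor_)) (isEvenᵇ≡not-parity v) right-parity) ,
  noShortCycleᵇ⇒NoShortCycle v no-short
  where
  parity≡ : ∀ o {p} → T (o xor not p) → p ≡ o
  parity≡ false {false} _ = refl
  parity≡ false {true} ()
  parity≡ true {false} ()
  parity≡ true {true} _ = refl

⇒Goodᵇ : ∀ {o} (f : Fin n → Fin n) → Injective _≡_ _≡_ f → parity f ≡ o → NoShortCycle t f →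
         T (Goodᵇ t o (Vec.tabulate f))
⇒Goodᵇ f f-inj refl no-short = Equivalence.from T-∧ (injective⇒isPermᵇ f f-inj ,
  Equivalence.from T-∧ (subst (T ∘ (parity f xor_)) (sym isEven) (xor-not (parity f)) ,
                        NoShortCycle⇒noShortCycleᵇ f no-short))
  where
  isEven : isEvenᵇ (Vec.tabulate f) ≡ not (parity f)
  isEven = trans (isEvenᵇ≡not-parity (Vec.tabulate f)) (cong (not ∘ odd) (inversionCount-cong (lookup∘tabulate f)))
  xor-not : ∀ p → T (p xor not p)
  xor-not false = tt
  xor-not true = tt

∈-good⁻ : ∀ {o} {v : Vec (Fin n) n} → v ∈ good t o n → T (Goodᵇ t o v)
∈-good⁻ {n} {t} {o} v∈ = proj₂ (∈-filter⁻ (T? ∘ Goodᵇ t o) {xs = allVecs n n} v∈)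

cyclePermVec : Vec (Fin m) m → Choice k m → Vec (Fin (suc (k + m))) (suc (k + m))
cyclePermVec σ c = Vec.tabulate (cyclePerm c (lookup σ))

lookup-tabulate-injective : ∀ {f g : Fin n → Fin n} → Vec.tabulate f ≡ Vec.tabulate g → ∀ x → f x ≡ g x
lookup-tabulate-injective {f = f} {g} eq x =
  trans (sym (lookup∘tabulate f x)) (trans (cong (λ v → lookup v x) eq) (lookup∘tabulate g x))

cyclePermVec-injective : ∀ {σ σ' : Vec (Fin m) m} {c c' : Choice k m} →
                         cyclePermVec σ c ≡ cyclePermVec σ' c' → σ ≡ σ' × c ≡ c'
cyclePermVec-injective {σ = σ} {σ'} eq with cyclePerm-determines (lookup-tabulate-injective eq)
... | c≡c' , σ≗σ' = trans (sym (tabulate∘lookup σ)) (trans (tabulate-cong σ≗σ') (tabulate∘lookup σ')) , c≡c'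

-- The permutations with 0 on a cycle of length k + 1, built from good permutations of the other m points; the
-- index N = k + m lets classes for different k share one type.
cycleClass : ∀ t o k m N → k + m ≡ N → List (Vec (Fin (suc N)) (suc N))
cycleClass t o k m .(k + m) refl = cartesianProductWith cyclePermVec (good t (odd k xor o) m) (allChoices k m)

module _ (t : ℕ) (o : Bool) (k m : ℕ) where

  cycleClass-unique : ∀ {N} (eq : k + m ≡ N) → Unique (cycleClass t o k m N eq)
  cycleClass-unique refl = cartesianProductWith⁺ cyclePermVec cyclePermVec-injective
                             (filter⁺ (T? ∘ Goodᵇ t (odd k xor o)) (allVecs-unique m m)) (allChoices-unique k m)

  length-cycleClass : ∀ {N} (eq : k + m ≡ N) →
                      length (cycleClass t o k m N eq) ≡ #good t (odd k xor o) m * length (allChoices k m)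
  length-cycleClass refl = length-cartesianProductWith cyclePermVec (good t (odd k xor o) m) (allChoices k m)

  ∈-cycleClass⁻ : ∀ {N} (eq : k + m ≡ N) {v} → v ∈ cycleClass t o k m N eq →
                  ZeroOnCycleOfLength (suc k) (lookup v) × (t ≤ k → T (Goodᵇ t o v))
  ∈-cycleClass⁻ refl v∈ with ∈-cartesianProductWith⁻ cyclePermVec (good t (odd k xor o) m) (allChoices k m) v∈
  ... | σ , c , σ∈ , _ , refl with Goodᵇ⇒ {t = t} σ (∈-good⁻ {t = t} {odd k xor o} σ∈)
  ...   | σ-inj , σ-parity , σ-ok = zero-cycle , good-perm
    where
    ρ = cyclePerm c (lookup σ)
    zero-cycle : ZeroOnCycleOfLength (suc k) (lookup (Vec.tabulate ρ))
    zero-cycle = ZeroOnCycleOfLength-cong (λ x → sym (lookup∘tabulate ρ x)) (cyclePerm-zeroCycle c (lookup σ))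
    good-perm : t ≤ k → T (Goodᵇ t o (Vec.tabulate ρ))
    good-perm t≤k = ⇒Goodᵇ ρ (cyclePerm-injective c (lookup σ) σ-inj) (begin
      parity ρ                          ≡⟨ parity-cyclePerm c (lookup σ) σ-inj ⟩
      odd k xor parity (lookup σ)       ≡⟨ cong (odd k xor_) σ-parity ⟩
      odd k xor (odd k xor o)           ≡⟨ xor-assoc (odd k) (odd k) o ⟨
      (odd k xor odd k) xor o           ≡⟨ cong (_xor o) (xor-same (odd k)) ⟩
      o                                 ∎)
      (cyclePerm-noShortCycle c (lookup σ) t≤k σ-ok)
      where open ≡-Reasoning

∑≤ : (ℕ → ℕ) → ℕ → ℕ
∑≤ f zero = f zero
∑≤ f (suc d) = f (suc d) + ∑≤ f d

module _ (t : ℕ) (o : Bool) (N : ℕ) where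

  class : ∀ m → m ≤ N → List (Vec (Fin (suc N)) (suc N))
  class m m≤N = cycleClass t o (N ∸ m) m N (m∸n+n≡m m≤N)

  classSize : ℕ → ℕ
  classSize m = #good t (odd (N ∸ m) xor o) m * length (allChoices (N ∸ m) m)

  classes : ∀ d → d ≤ N → List (Vec (Fin (suc N)) (suc N))
  classes zero d≤N = class zero d≤N
  classes (suc d) d<N = class (suc d) d<N ++ classes d (<⇒≤ d<N)

  ∈-classes⁻ : ∀ d d≤N {v} → v ∈ classes d d≤N →
               ∃ λ m → m ≤ d × ZeroOnCycleOfLength (suc (N ∸ m)) (lookup v) × (t ≤ N ∸ m → T (Goodᵇ t o v))
  ∈-classes⁻ zero d≤N v∈ = zero , z≤n , ∈-cycleClass⁻ t o N zero (m∸n+n≡m d≤N) v∈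
  ∈-classes⁻ (suc d) d<N v∈ with ∈-++⁻ (class (suc d) d<N) v∈
  ... | inj₁ v∈class = suc d , ≤-refl , ∈-cycleClass⁻ t o (N ∸ suc d) (suc d) (m∸n+n≡m d<N) v∈class
  ... | inj₂ v∈classes with ∈-classes⁻ d (<⇒≤ d<N) v∈classes
  ...   | m , m≤d , props = m , m≤n⇒m≤1+n m≤d , props

  classes-unique : ∀ d d≤N → Unique (classes d d≤N)
  classes-unique zero d≤N = cycleClass-unique t o N zero (m∸n+n≡m d≤N)
  classes-unique (suc d) d<N =
    ++⁺ (cycleClass-unique t o (N ∸ suc d) (suc d) (m∸n+n≡m d<N)) (classes-unique d (<⇒≤ d<N)) disjoint
    where
    disjoint : ∀ {v} → ¬ (v ∈ class (suc d) d<N × v ∈ classes d (<⇒≤ d<N))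
    disjoint (v∈class , v∈classes) with ∈-classes⁻ d (<⇒≤ d<N) v∈classes
    ... | m , m≤d , zero-cycle , _ =
      ZeroOnCycleOfLength-unique (proj₁ (∈-cycleClass⁻ t o (N ∸ suc d) (suc d) (m∸n+n≡m d<N) v∈class))
                                 zero-cycle (s≤s (∸-monoʳ-< (s≤s m≤d) d<N))

  length-classes : ∀ d d≤N → length (classes d d≤N) ≡ ∑≤ classSize d
  length-classes zero d≤N = length-cycleClass t o N zero (m∸n+n≡m d≤N)
  length-classes (suc d) d<N = trans (length-++ (class (suc d) d<N))
    (cong₂ _+_ (length-cycleClass t o (N ∸ suc d) (suc d) (m∸n+n≡m d<N)) (length-classes d (<⇒≤ d<N)))

  -- Only a lower bound: the construction is injective but not shown to be onto.
  ∑≤classSize≤#good : t ≤ N → ∑≤ classSize (N ∸ t) ≤ #good t o (suc N)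
  ∑≤classSize≤#good t≤N = subst (_≤ #good t o (suc N)) (length-classes (N ∸ t) (m∸n≤m N t))
    (Unique⇒length≤countVecs (suc N) (Goodᵇ t o) (classes-unique (N ∸ t) (m∸n≤m N t))
      (All.tabulate (λ {v} v∈ → good-member {v} (∈-classes⁻ (N ∸ t) (m∸n≤m N t) v∈))))
    where
    good-member : ∀ {v} → (∃ λ m → m ≤ N ∸ t × ZeroOnCycleOfLength (suc (N ∸ m)) (lookup v) ×
                                   (t ≤ N ∸ m → T (Goodᵇ t o v))) → T (Goodᵇ t o v)
    good-member (m , m≤N∸t , _ , good-if) =
      good-if (subst (_≤ N ∸ m) (m∸[m∸n]≡n t≤N) (∸-monoʳ-≤ N m≤N∸t))

∑≤-*ˡ : ∀ c (f : ℕ → ℕ) d → ∑≤ (λ m → c * f m) d ≡ c * ∑≤ f d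
∑≤-*ˡ c f zero = refl
∑≤-*ˡ c f (suc d) = trans (cong (_+_ (c * f (suc d))) (∑≤-*ˡ c f d)) (sym (*-distribˡ-+ c (f (suc d)) (∑≤ f d)))

∑≤-lower-bound : ∀ (f : ℕ → ℕ) {a s x y} d → s < a → s ≤ d → y ≤ f s →
                 (∀ {m} → a ≤ m → m ≤ d → x ≤ f m) → y + (suc d ∸ a) * x ≤ ∑≤ f d
∑≤-lower-bound f {a} {x = x} {y} zero s<a z≤n y≤fs _ = begin
  y + (1 ∸ a) * x ≡⟨ cong (λ l → y + l * x) (m≤n⇒m∸n≡0 s<a) ⟩
  y + 0           ≡⟨ +-identityʳ y ⟩
  y               ≤⟨ y≤fs ⟩
  f zero          ∎
  where open ≤-Reasoning
∑≤-lower-bound f {a} {s} {x} {y} (suc d) s<a s≤sd y≤fs tail with m≤n⇒m<n∨m≡n s≤sd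
... | inj₂ refl = begin
  y + (suc (suc d) ∸ a) * x ≡⟨ cong (λ l → y + l * x) (m≤n⇒m∸n≡0 s<a) ⟩
  y + 0                     ≡⟨ +-identityʳ y ⟩
  y                         ≤⟨ ≤-trans y≤fs (m≤m+n _ _) ⟩
  f (suc d) + ∑≤ f d        ∎
  where open ≤-Reasoning
... | inj₁ (s≤s s≤d) with a ≤? suc d
...   | yes a≤sd = begin
  y + (suc (suc d) ∸ a) * x   ≡⟨ cong (λ l → y + l * x) (+-∸-assoc 1 a≤sd) ⟩
  y + (x + (suc d ∸ a) * x)   ≡⟨ +-comm-middle ⟩
  x + (y + (suc d ∸ a) * x)   ≤⟨ +-mono-≤ (tail a≤sd ≤-refl) IH ⟩
  f (suc d) + ∑≤ f d          ∎
  where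
  open ≤-Reasoning
  IH = ∑≤-lower-bound f d s<a s≤d y≤fs (λ a≤m m≤d → tail a≤m (m≤n⇒m≤1+n m≤d))
  +-comm-middle : y + (x + (suc d ∸ a) * x) ≡ x + (y + (suc d ∸ a) * x)
  +-comm-middle = trans (sym (+-assoc y x _)) (trans (cong (_+ (suc d ∸ a) * x) (+-comm y x)) (+-assoc x y _))
...   | no a≰sd = begin
  y + (suc (suc d) ∸ a) * x   ≡⟨ cong (λ l → y + l * x) (trans (m≤n⇒m∸n≡0 sd<a) (sym (m≤n⇒m∸n≡0 (<⇒≤ sd<a)))) ⟩
  y + (suc d ∸ a) * x         ≤⟨ ∑≤-lower-bound f d s<a s≤d y≤fs (λ a≤m m≤d → tail a≤m (m≤n⇒m≤1+n m≤d)) ⟩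
  ∑≤ f d                      ≤⟨ m≤n+m _ _ ⟩
  f (suc d) + ∑≤ f d          ∎
  where
  open ≤-Reasoning
  sd<a = ≰⇒> a≰sd

length-allChoices-∸ : ∀ {m N} → m ≤ N → length (allChoices (N ∸ m) m) * m ! ≡ N !
length-allChoices-∸ {m} {N} m≤N = trans (length-allChoices (N ∸ m) m) (cong _! (m∸n+n≡m m≤N))

module Bounds (t : ℕ) where

  K c : ℕ
  K = 2 + 3 * t
  c = K * suc t

  t!≤#good : t ! ≤ #good t (odd t) (suc t)
  t!≤#good = begin
    t !                                  ≡⟨ length-allChoices-∸ {0} {t} z≤n ⟨
    choices * 1                          ≡⟨ *-comm choices 1 ⟩
    1 * choices                          ≡⟨ cong (λ o → #good t o 0 * choices) (xor-same (odd t)) ⟨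
    classSize t (odd t) t 0              ≡⟨ cong (∑≤ (classSize t (odd t) t)) (n∸n≡0 t) ⟨
    ∑≤ (classSize t (odd t) t) (t ∸ t)   ≤⟨ ∑≤classSize≤#good t (odd t) t ≤-refl ⟩
    #good t (odd t) (suc t)              ∎
    where
    open ≤-Reasoning
    choices = length (allChoices t 0)

  2+t≤2t+2 : 2 + t ≤ 2 * t + 2
  2+t≤2t+2 = subst (2 + t ≤_) (+-comm 2 (2 * t)) (+-monoʳ-≤ 2 (m≤m+n t (t + 0)))

  module _ (o : Bool) (N : ℕ) where

    classSize-≥ : ∀ m → m ≤ N → m ! ≤ c * #good t (odd (N ∸ m) xor o) m → N ! ≤ c * classSize t o N m
    classSize-≥ m m≤N m!≤ = begin
      N !                          ≡⟨ length-allChoices-∸ m≤N ⟨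
      choices * m !                ≤⟨ *-monoʳ-≤ choices m!≤ ⟩
      choices * (c * goods)        ≡⟨ trans (*-comm choices _) (*-assoc c goods choices) ⟩
      c * (goods * choices)        ∎
      where
      open ≤-Reasoning
      choices = length (allChoices (N ∸ m) m)
      goods = #good t (odd (N ∸ m) xor o) m

    -- Whatever o is, the class m = 0 (one (N+1)-cycle) or the class m = t + 1 has the required parity.
    small-class : suc t ≤ N ∸ t → ∃ λ s → s < 2 * t + 2 × s ≤ N ∸ t × K * N ! ≤ c * classSize t o N s
    small-class st≤N∸t with odd N xor o in parity
    ... | false = 0 , ≤-trans (s≤s z≤n) 2+t≤2t+2 , z≤n , (begin
      K * N !                              ≤⟨ *-monoˡ-≤ (N !) (m≤m*n K (suc t)) ⟩
      c * N !                              ≡⟨ cong (c *_) one-class ⟨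
      c * (1 * length (allChoices N 0))    ≡⟨ cong (λ o′ → c * (#good t o′ 0 * length (allChoices N 0))) parity ⟨
      c * classSize t o N 0                ∎)
      where
      open ≤-Reasoning
      one-class : 1 * length (allChoices N 0) ≡ N !
      one-class = trans (+-identityʳ _) (trans (sym (*-identityʳ _)) (length-allChoices-∸ {0} {N} z≤n))
    ... | true = suc t , 2+t≤2t+2 , st≤N∸t , (begin
      K * N !                                       ≡⟨ cong (K *_) (length-allChoices-∸ st≤N) ⟨
      K * (choices * suc t !)                       ≡⟨ rearrange K (suc t) (t !) choices ⟩
      c * (t ! * choices)                           ≤⟨ *-monoʳ-≤ c (*-monoˡ-≤ choices t!≤#good) ⟩
      c * (#good t (odd t) (suc t) * choices)       ≡⟨ cong (λ o′ → c * (#good t o′ (suc t) * choices)) parity′ ⟨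
      c * classSize t o N (suc t)                   ∎)
      where
      open ≤-Reasoning
      st≤N = ≤-trans st≤N∸t (m∸n≤m N t)
      choices = length (allChoices (N ∸ suc t) (suc t))
      rearrange : ∀ k s f x → k * (x * (s * f)) ≡ (k * s) * (f * x)
      rearrange = solve-∀
      N≡ : odd N ≡ odd (N ∸ suc t) xor not (odd t)
      N≡ = trans (cong odd (sym (m∸n+n≡m st≤N))) (odd-+ (N ∸ suc t) (suc t))
      right-parity : ∀ a b o → ∀ {n} → n ≡ a xor not b → n xor o ≡ true → a xor o ≡ b
      right-parity false false false refl _ = refl
      right-parity false false true refl ()
      right-parity false true false refl ()
      right-parity false true true refl _ = refl
      right-parity true false false refl ()
      right-parity true false true refl _ = refl
      right-parity true true false refl _ = refl
      right-parity true true true refl ()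
      parity′ = right-parity (odd (N ∸ suc t)) (odd t) o N≡ parity

  private
    threshold≡ : ∀ t → 2 * t + 2 ≡ 2 + (t + t)
    threshold≡ = solve-∀

    K≡ : ∀ t → t + (2 * t + 2) ≡ 2 + 3 * t
    K≡ = solve-∀

  factorial≤c*#good : ∀ M → 2 * t + 2 ≤ M → ∀ o → M ! ≤ c * #good t o M
  factorial≤c*#good = <-rec (λ M → 2 * t + 2 ≤ M → ∀ o → M ! ≤ c * #good t o M) step
    where
    step : ∀ M → (∀ {m} → m < M → 2 * t + 2 ≤ m → ∀ o → m ! ≤ c * #good t o m) →
           2 * t + 2 ≤ M → ∀ o → M ! ≤ c * #good t o M
    step zero _ le _ = ⊥-elim (n≮0 (subst (_≤ 0) (threshold≡ t) le))
    step (suc N) IH le o with small-class o N st≤N∸t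
      where st≤N∸t = m+n≤o⇒m≤o∸n (suc t) (s≤s⁻¹ (subst (_≤ suc N) (threshold≡ t) le))
    ... | s , s<T₂ , s≤d , small = begin
      suc N * N !                                ≤⟨ *-monoˡ-≤ (N !) count ⟩
      (K + (suc d ∸ T₂)) * N !                   ≡⟨ *-distribʳ-+ (N !) K _ ⟩
      K * N ! + (suc d ∸ T₂) * N !               ≤⟨ ∑≤-lower-bound (λ m → c * classSize t o N m) d s<T₂ s≤d small tail ⟩
      ∑≤ (λ m → c * classSize t o N m) d        ≡⟨ ∑≤-*ˡ c (classSize t o N) d ⟩
      c * ∑≤ (classSize t o N) d                ≤⟨ *-monoʳ-≤ c (∑≤classSize≤#good t o N t≤N) ⟩
      c * #good t o (suc N)                     ∎
      where
      open ≤-Reasoning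
      T₂ = 2 * t + 2
      d = N ∸ t
      t≤N : t ≤ N
      t≤N = s≤s⁻¹ (≤-trans (n≤1+n (suc t)) (≤-trans 2+t≤2t+2 le))
      tail : ∀ {m} → T₂ ≤ m → m ≤ d → N ! ≤ c * classSize t o N m
      tail {m} T₂≤m m≤d = classSize-≥ o N m m≤N (IH (s≤s m≤N) T₂≤m (odd (N ∸ m) xor o))
        where m≤N = ≤-trans m≤d (m∸n≤m N t)
      count : suc N ≤ K + (suc d ∸ T₂)
      count = begin
        suc N                       ≡⟨ cong suc (m+[n∸m]≡n t≤N) ⟨
        suc (t + d)                 ≡⟨ +-suc t d ⟨
        t + suc d                   ≤⟨ +-monoʳ-≤ t (m≤n+m∸n (suc d) T₂) ⟩
        t + (T₂ + (suc d ∸ T₂))     ≡⟨ +-assoc t T₂ _ ⟨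
        t + T₂ + (suc d ∸ T₂)       ≡⟨ cong (_+ (suc d ∸ T₂)) (K≡ t) ⟩
        K + (suc d ∸ T₂)            ∎

  factorial≤c*min : ∀ n → 2 * t + 2 ≤ n → n ! ≤ c * (E n t ⊓ O n t)
  factorial≤c*min n le = subst (n ! ≤_) (sym (*-distribˡ-⊓ c (E n t) (O n t)))
                               (⊓-glb (factorial≤c*#good n le false) (factorial≤c*#good n le true))

1/c-positive : ∀ c .{{_ : NonZero c}} → 0ℚ <ℚ (+ 1) / c
1/c-positive (suc c) = toℚᵘ-cancel-< (<-respʳ-≃ (≃-sym (toℚᵘ-fromℚᵘ (mkℚᵘ (+ 1) c))) (*<* (+<+ (s≤s z≤n))))

-- Cross-multiplying in ℚᵘ, where 1/c · a/1 is literally (1 · a)/(c · 1).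
1/c*a≤b : ∀ c a b .{{_ : NonZero c}} → a ≤ b * c → ((+ 1) / c) *ℚ ((+ a) / 1) ≤ℚ ((+ b) / 1)
1/c*a≤b (suc c) a b a≤bc =
  toℚᵘ-cancel-≤ (≤-respˡ-≃ normalise-* (≤-respʳ-≃ (≃-sym (toℚᵘ-fromℚᵘ (mkℚᵘ (+ b) 0))) unnormalised))
  where
  1/c = mkℚᵘ (+ 1) c
  a/1 = mkℚᵘ (+ a) 0
  unnormalised : 1/c *ᵘ a/1 ≤ᵘ mkℚᵘ (+ b) 0
  unnormalised = *≤* (subst₂ _≤ℤ_ (sym (trans (ℤ.*-identityʳ _) (ℤ.*-identityˡ _)))
                                 (trans (ℤ.pos-* b (suc c)) (cong (λ d → + b *ℤ + d) (sym (*-identityʳ (suc c)))))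
                                 (+≤+ a≤bc))
  normalise-* : 1/c *ᵘ a/1 ≃ᵘ toℚᵘ (fromℚᵘ 1/c *ℚ fromℚᵘ a/1)
  normalise-* = ≃-sym (≃-trans (toℚᵘ-homo-* (fromℚᵘ 1/c) (fromℚᵘ a/1)) (*-cong (toℚᵘ-fromℚᵘ 1/c) (toℚᵘ-fromℚᵘ a/1)))

lemma7 : (t : ℕ) → Σ ℚ (λ L → (0ℚ <ℚ L) × ((n : ℕ) → 2 * t + 2 ≤ n → L *ℚ ((+ (n !)) / 1) ≤ℚ ((+ (E n t ⊓ O n t)) / 1)))
lemma7 t = (+ 1) / c , 1/c-positive c ,
           λ n le → 1/c*a≤b c (n !) (E n t ⊓ O n t) (subst (n ! ≤_) (*-comm c _) (factorial≤c*min n le))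
  where open Bounds t
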